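{- Let $G=(V,E)$ be a graph with at least two vertices and let $u\in V$. Then $G$ admits a generalized $2$-community structure $\{C_1,C_2\}$ with $C_i=\{u\}$ for some $i\in\{1,2\}$ if and only if every neighbour of $u$ is universal in $G$.
   Context: A vertex $v$ is universal if $N[v]=V$. $N_C(v)$ denotes the set of neighbours of $v$ in $C$. A generalized $2$-community structure of $G$ is a partition of $V$ into two nonempty sets $C_1,C_2$ such that for $i\in\{1,2\}$ and every $v\in C_i$: $|N_{C_i}(v)|\cdot|C_{3-i}|\ge |N_{C_{3-i}}(v)|\cdot(|C_i|-1)$. -}

module Defs where

open import Data.Nat using (ℕ; _*_; _≤_; _∸_; _≥_)
open import Data.Bool using (Bool; true; false; not)
open import Data.Fin using (Fin)
open import Data.Vec using (tabulate; lookup)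
open import Data.Fin.Subset using (Subset; _∈_; _∉_; ∣_∣; _∩_; ∁; Nonempty; ⁅_⁆)
open import Relation.Binary.PropositionalEquality using (_≡_)
open import Data.Product using (_×_)
open import Data.Sum using (_⊎_)

record Graph (n : ℕ) : Set where
  field
    adj   : Fin n → Fin n → Bool
    sym   : ∀ u v → adj u v ≡ adj v u
    irrefl : ∀ v → adj v v ≡ false

open Graph public

N : ∀ {n} → Graph n → Fin n → Subset n
N G v = tabulate (λ w → adj G v w)

degIn : ∀ {n} → Graph n → Fin n → Subset n → ℕ
degIn G v C = ∣ N G v ∩ C ∣

Universal : ∀ {n} → Graph n → Fin n → Set
Universal G v = ∀ w → w ≡ v ⊎ adj G v w ≡ true

CommCond : ∀ {n} → Graph n → Subset n → Subset n → Fin n → Set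
CommCond G C D v = degIn G v C * ∣ D ∣ ≥ degIn G v D * (∣ C ∣ ∸ 1)

Gen2Comm : ∀ {n} → Graph n → Subset n → Set
Gen2Comm G C₁ =
  Nonempty C₁ × Nonempty (∁ C₁) ×
  (∀ v → v ∈ C₁ → CommCond G C₁ (∁ C₁) v) ×
  (∀ v → v ∈ ∁ C₁ → CommCond G (∁ C₁) C₁ v)

-- Put C₂ = V ∖ {u}, so |C₂| - 1 = |C₂ ∖ {v}| = n - 2. The condition for u is
-- vacuous (|{u}| - 1 = 0), and for v ∈ C₂ it reads |N_{C₂}(v)| ≥ n - 2 when v ~ u
-- and is trivial otherwise. As v has no loop, N_{C₂}(v) ⊆ C₂ ∖ {v}, so the bound
-- holds exactly when v is adjacent to every vertex of C₂ ∖ {v}, i.e. (together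
-- with v ~ u) when v is universal.
module Submission where

open import Defs hiding (sym)
open import Data.Bool using (true; false; not)
open import Data.Bool.Properties using (not-involutive)
open import Data.Nat using (ℕ; suc; _≥_; _∸_; _*_; _≤_; z≤n; s≤s)
open import Data.Nat.Properties using (≤⇒≯; ≤-antisym; *-identityˡ; *-identityʳ; *-zeroʳ)
open import Data.Fin using (Fin; zero; suc; _≟_)
open import Data.Fin.Subset
  using (Subset; _∈_; _∉_; _⊆_; _∩_; _-_; ∁; ⁅_⁆; ∣_∣; Nonempty; inside; outside)
open import Data.Fin.Subset.Properties
  using (_∈?_; p⊂q⇒∣p∣<∣q∣; p⊆q⇒∣p∣≤∣q∣; x∈p∩q⁺; x∈p∩q⁻; p─q⊆p; p─⊥≡p;
         x∈p∧x≢y⇒x∈p-y; x∉p⇒x∈∁p; x≢y⇒x∉⁅y⁆;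
         x∈⁅x⁆; x∈⁅y⁆⇒x≡y; ∣⁅x⁆∣≡1; ∣p∩q∣≤∣q∣; Empty-unique; ∣⊥∣≡0)
open import Data.Vec.Properties using (lookup∘tabulate; lookup⇒[]=; []=⇒lookup; map-∘; map-cong; map-id)
open import Data.Vec.Base using (_∷_; here; there)
open import Data.Product using (Σ; _×_; _,_; proj₁)
open import Data.Sum using (_⊎_; inj₁; inj₂)
open import Function.Bundles using (_⇔_; mk⇔; Equivalence)
import Function.Properties.Equivalence as ⇔
open import Relation.Nullary using (¬_; yes; no; contradiction)
open import Relation.Binary.PropositionalEquality
  using (_≡_; _≢_; refl; sym; trans; cong; cong₂; subst)

open Equivalence using (to; from)

private
  variable
    n : ℕ

∁-involutive : (p : Subset n) → ∁ (∁ p) ≡ p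
∁-involutive p = trans (sym (map-∘ not not p)) (trans (map-cong not-involutive p) (map-id p))

x≢y⇒x∈∁⁅y⁆ : {x y : Fin n} → x ≢ y → x ∈ ∁ ⁅ y ⁆
x≢y⇒x∈∁⁅y⁆ x≢y = x∉p⇒x∈∁p (x≢y⇒x∉⁅y⁆ x≢y)

∁⁅x⁆-nonempty : ∀ {m} (x : Fin (suc (suc m))) → Nonempty (∁ ⁅ x ⁆)
∁⁅x⁆-nonempty zero    = suc zero , x≢y⇒x∈∁⁅y⁆ {y = zero} λ ()
∁⁅x⁆-nonempty (suc x) = zero , x≢y⇒x∈∁⁅y⁆ {y = suc x} λ ()

∣p-x∣+1≡∣p∣ : {p : Subset n} {x : Fin n} → x ∈ p → suc ∣ p - x ∣ ≡ ∣ p ∣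
∣p-x∣+1≡∣p∣ {p = inside ∷ p}  here        = cong (λ q → suc ∣ q ∣) (p─⊥≡p p)
∣p-x∣+1≡∣p∣ {p = inside ∷ p}  (there x∈p) = cong suc (∣p-x∣+1≡∣p∣ x∈p)
∣p-x∣+1≡∣p∣ {p = outside ∷ p} (there x∈p) = ∣p-x∣+1≡∣p∣ x∈p

∣p∩⁅x⁆∣≡1 : {p : Subset n} {x : Fin n} → x ∈ p → ∣ p ∩ ⁅ x ⁆ ∣ ≡ 1
∣p∩⁅x⁆∣≡1 {p = p} {x} x∈p = trans (≤-antisym (∣p∩q∣≤∣q∣ p ⁅ x ⁆) (p⊆q⇒∣p∣≤∣q∣ ⁅x⁆⊆p∩⁅x⁆)) (∣⁅x⁆∣≡1 x)
  where
  ⁅x⁆⊆p∩⁅x⁆ : ⁅ x ⁆ ⊆ p ∩ ⁅ x ⁆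
  ⁅x⁆⊆p∩⁅x⁆ y∈⁅x⁆ rewrite x∈⁅y⁆⇒x≡y x y∈⁅x⁆ = x∈p∩q⁺ (x∈p , x∈⁅x⁆ x)

∣p∩⁅x⁆∣≡0 : {p : Subset n} {x : Fin n} → x ∉ p → ∣ p ∩ ⁅ x ⁆ ∣ ≡ 0
∣p∩⁅x⁆∣≡0 {n} {p} {x} x∉p = trans (cong ∣_∣ (Empty-unique p∩⁅x⁆-empty)) (∣⊥∣≡0 n)
  where
  p∩⁅x⁆-empty : ¬ Nonempty (p ∩ ⁅ x ⁆)
  p∩⁅x⁆-empty (y , y∈) with x∈p∩q⁻ p ⁅ x ⁆ y∈
  ... | y∈p , y∈⁅x⁆ rewrite x∈⁅y⁆⇒x≡y x y∈⁅x⁆ = x∉p y∈p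

x∉p-x : {p : Subset n} (x : Fin n) → x ∉ p - x
x∉p-x {p = _ ∷ _} zero    ()
x∉p-x {p = _ ∷ _} (suc x) (there x∈p-x) = x∉p-x x x∈p-x

p⊆q⇒[q⊆p⇔∣q∣≤∣p∣] : {p q : Subset n} → p ⊆ q → q ⊆ p ⇔ ∣ q ∣ ≤ ∣ p ∣
p⊆q⇒[q⊆p⇔∣q∣≤∣p∣] {p = p} {q} p⊆q = mk⇔ p⊆q⇒∣p∣≤∣q∣ q⊆p
  where
  q⊆p : ∣ q ∣ ≤ ∣ p ∣ → q ⊆ p
  q⊆p ∣q∣≤∣p∣ {x} x∈q with x ∈? p
  ... | yes x∈p = x∈p
  ... | no  x∉p = contradiction (p⊂q⇒∣p∣<∣q∣ (p⊆q , x , x∈q , x∉p)) (≤⇒≯ ∣q∣≤∣p∣)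

module _ (G : Graph n) where

  adj⇒∈N : ∀ {v w} → adj G v w ≡ true → w ∈ N G v
  adj⇒∈N {v} {w} e = lookup⇒[]= w _ (trans (lookup∘tabulate (adj G v) w) e)

  ∈N⇒adj : ∀ {v w} → w ∈ N G v → adj G v w ≡ true
  ∈N⇒adj {v} {w} w∈ = trans (sym (lookup∘tabulate (adj G v) w)) ([]=⇒lookup w∈)

  adj⇒≢ : ∀ {v w} → adj G v w ≡ true → w ≢ v
  adj⇒≢ {v} e refl = contradiction (trans (sym e) (irrefl G v)) λ ()

  N∩p⊆p-v : ∀ v p → N G v ∩ p ⊆ p - v
  N∩p⊆p-v v p w∈ with x∈p∩q⁻ (N G v) p w∈
  ... | w∈N , w∈p = x∈p∧x≢y⇒x∈p-y w∈p (adj⇒≢ (∈N⇒adj w∈N))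

  universal⇔∁⁅u⁆-v⊆N : ∀ {u v} → adj G v u ≡ true →
                        Universal G v ⇔ (∁ ⁅ u ⁆ - v ⊆ N G v ∩ ∁ ⁅ u ⁆)
  universal⇔∁⁅u⁆-v⊆N {u} {v} vu = mk⇔ covers universal
    where
    covers : Universal G v → ∁ ⁅ u ⁆ - v ⊆ N G v ∩ ∁ ⁅ u ⁆
    covers U {w} w∈ with U w
    ... | inj₁ refl = contradiction w∈ (x∉p-x v)
    ... | inj₂ vw   = x∈p∩q⁺ (adj⇒∈N vw , p─q⊆p _ _ w∈)
    universal : ∁ ⁅ u ⁆ - v ⊆ N G v ∩ ∁ ⁅ u ⁆ → Universal G v
    universal ⊆N w with w ≟ v | w ≟ u
    ... | yes w≡v | _       = inj₁ w≡v
    ... | no  _   | yes refl = inj₂ vu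
    ... | no  w≢v | no  w≢u =
      inj₂ (∈N⇒adj (proj₁ (x∈p∩q⁻ (N G v) _ (⊆N (x∈p∧x≢y⇒x∈p-y (x≢y⇒x∈∁⁅y⁆ w≢u) w≢v)))))

  universal⇔∣∁⁅u⁆-v∣≤degIn : ∀ {u v} → adj G v u ≡ true →
                             Universal G v ⇔ ∣ ∁ ⁅ u ⁆ - v ∣ ≤ degIn G v (∁ ⁅ u ⁆)
  universal⇔∣∁⁅u⁆-v∣≤degIn {u} {v} vu =
    ⇔.trans (universal⇔∁⁅u⁆-v⊆N vu) (p⊆q⇒[q⊆p⇔∣q∣≤∣p∣] (N∩p⊆p-v v (∁ ⁅ u ⁆)))

  degIn⁅u⁆*k≤d⇔ : ∀ {u v} k d → degIn G v ⁅ u ⁆ * k ≤ d ⇔ (adj G v u ≡ true → k ≤ d)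
  degIn⁅u⁆*k≤d⇔ {u} {v} k d with adj G v u in vu
  ... | true  = mk⇔ (λ le _ → subst (_≤ d) deg*k≡k le) (λ h → subst (_≤ d) (sym deg*k≡k) (h refl))
    where
    deg*k≡k : degIn G v ⁅ u ⁆ * k ≡ k
    deg*k≡k = trans (cong (_* k) (∣p∩⁅x⁆∣≡1 (adj⇒∈N vu))) (*-identityˡ k)
  ... | false = mk⇔ (λ _ ()) (λ _ → subst (_≤ d) (sym (cong (_* k) deg≡0)) z≤n)
    where
    deg≡0 : degIn G v ⁅ u ⁆ ≡ 0
    deg≡0 = ∣p∩⁅x⁆∣≡0 λ u∈N → contradiction (trans (sym vu) (∈N⇒adj u∈N)) λ ()

  commCond-⁅u⁆ : ∀ u D v → CommCond G ⁅ u ⁆ D v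
  commCond-⁅u⁆ u D v rewrite ∣⁅x⁆∣≡1 u | *-zeroʳ (degIn G v D) = z≤n

  commCond-∁⁅u⁆⇔ : ∀ {u v} → v ∈ ∁ ⁅ u ⁆ →
                   CommCond G (∁ ⁅ u ⁆) ⁅ u ⁆ v ⇔ (adj G u v ≡ true → Universal G v)
  commCond-∁⁅u⁆⇔ {u} {v} v∈ =
    ⇔.trans (subst (CommCond G (∁ ⁅ u ⁆) ⁅ u ⁆ v ⇔_) normalised ⇔.refl)
            (⇔.trans (degIn⁅u⁆*k≤d⇔ _ _) (mk⇔ to-universal from-universal))
    where
    normalised : CommCond G (∁ ⁅ u ⁆) ⁅ u ⁆ v
               ≡ (degIn G v ⁅ u ⁆ * ∣ ∁ ⁅ u ⁆ - v ∣ ≤ degIn G v (∁ ⁅ u ⁆))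
    normalised = cong₂ (λ k d → degIn G v ⁅ u ⁆ * k ≤ d)
                       (cong (_∸ 1) (sym (∣p-x∣+1≡∣p∣ v∈)))
                       (trans (cong (degIn G v (∁ ⁅ u ⁆) *_) (∣⁅x⁆∣≡1 u)) (*-identityʳ _))
    to-universal : (adj G v u ≡ true → ∣ ∁ ⁅ u ⁆ - v ∣ ≤ degIn G v (∁ ⁅ u ⁆)) →
                   adj G u v ≡ true → Universal G v
    to-universal h uv = from (universal⇔∣∁⁅u⁆-v∣≤degIn vu) (h vu)
      where
      vu : adj G v u ≡ true
      vu = trans (Graph.sym G v u) uv
    from-universal : (adj G u v ≡ true → Universal G v) →
                     adj G v u ≡ true → ∣ ∁ ⁅ u ⁆ - v ∣ ≤ degIn G v (∁ ⁅ u ⁆)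
    from-universal h vu = to (universal⇔∣∁⁅u⁆-v∣≤degIn vu) (h (trans (Graph.sym G u v) vu))

  gen2Comm-∁ : ∀ {C} → Gen2Comm G C → Gen2Comm G (∁ C)
  gen2Comm-∁ {C} (ne , ne∁ , cond , cond∁) rewrite ∁-involutive C = ne∁ , ne , cond∁ , cond

  gen2Comm-⁅u⁆⇔ : ∀ {u} → Nonempty (∁ ⁅ u ⁆) →
                  Gen2Comm G ⁅ u ⁆ ⇔ (∀ v → adj G u v ≡ true → Universal G v)
  gen2Comm-⁅u⁆⇔ {u} ne∁ = mk⇔ neighboursUniversal gen2Comm
    where
    neighboursUniversal : Gen2Comm G ⁅ u ⁆ → ∀ v → adj G u v ≡ true → Universal G v
    neighboursUniversal (_ , _ , _ , cond∁) v uv = to (commCond-∁⁅u⁆⇔ v∈) (cond∁ v v∈) uv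
      where
      v∈ : v ∈ ∁ ⁅ u ⁆
      v∈ = x≢y⇒x∈∁⁅y⁆ (adj⇒≢ uv)
    gen2Comm : (∀ v → adj G u v ≡ true → Universal G v) → Gen2Comm G ⁅ u ⁆
    gen2Comm h = (u , x∈⁅x⁆ u) , ne∁ , (λ v _ → commCond-⁅u⁆ u _ v)
               , λ v v∈ → from (commCond-∁⁅u⁆⇔ v∈) (h v)

mainTheorem9 : (n : ℕ) → n ≥ 2 → (G : Graph n) → (u : Fin n) →
    (Σ (Subset n) (λ C₁ → Gen2Comm G C₁ × (C₁ ≡ ⁅ u ⁆ ⊎ ∁ C₁ ≡ ⁅ u ⁆)))
    ⇔ (∀ v → adj G u v ≡ true → Universal G v)
mainTheorem9 1 (s≤s ()) G u
mainTheorem9 (suc (suc m)) _ G u =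
  mk⇔ (λ (_ , gc , side) → to gen2Comm⇔ (singletonSide gc side))
      (λ h → ⁅ u ⁆ , from gen2Comm⇔ h , inj₁ refl)
  where
  gen2Comm⇔ : Gen2Comm G ⁅ u ⁆ ⇔ (∀ v → adj G u v ≡ true → Universal G v)
  gen2Comm⇔ = gen2Comm-⁅u⁆⇔ G (∁⁅x⁆-nonempty u)
  singletonSide : ∀ {C} → Gen2Comm G C → C ≡ ⁅ u ⁆ ⊎ ∁ C ≡ ⁅ u ⁆ → Gen2Comm G ⁅ u ⁆
  singletonSide gc (inj₁ refl) = gc
  singletonSide gc (inj₂ ∁C≡⁅u⁆) = subst (Gen2Comm G) ∁C≡⁅u⁆ (gen2Comm-∁ G gc)
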